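{- Let $K=(AP,S,R,S_0,I)$ be a Kripke structure and $x\notin AP$ an atomic proposition, and let $K'=(AP\cup\{x\},S',R',S'_0,I')$ be a Kripke structure that is $\{x\}$-bisimilar to $K$. Then $K'$ is simulated by the parallel synchronous composition $K\,\|\,\mathcal{X}$.
   Context: Here a Kripke structure $(AP,S,R,S_0,I)$ has atomic propositions $AP$, finite states $S$, total transition relation $R\subseteq S\times S$, a set $S_0\subseteq S$ of initial states, and labeling $I$ (write $I(s,p)\in\{\mathsf{true},\mathsf{false}\}$ for the value of $p$ at $s$). $\mathcal{X}=(\{x\},\{0,1\},\{0,1\},\{0,1\}\times\{0,1\},I^{\mathcal{X}})$ with $I^{\mathcal{X}}(0,x)=\mathsf{false}$, $I^{\mathcal{X}}(1,x)=\mathsf{true}$ (two states, both initial, all transitions). The parallel synchronous composition $K\|\mathcal{X}$ has atomic propositions $AP\cup\{x\}$, states $S\times\{0,1\}$, initial states $S_0\times\{0,1\}$, transitions $(\langle s,i\rangle,\langle t,j\rangle)$ iff $R(s,t)$, and labeling that agrees with $I(s)$ on $AP$ and with $I^{\mathcal{X}}(i)$ on $x$. $K'$ is $\{x\}$-bisimilar to $K$ iff its atomic propositions are $AP\cup\{x\}$ and there is a bisimulation w.r.t. $AP$ between $K$ and $K'$, i.e., a relation $\rho\subseteq S\times S'$ such that related states agree on $AP$, each transition of one of two related states is matched by a transition of the other to a related state (in both directions), and the initial states correspond (every initial state of each is related to some initial state of the other). A structure $M$ simulates $M'$ if there is a relation $\sigma$ between states of $M$ and $M'$ such that $\sigma(u,u')$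 implies $u,u'$ agree on all common atomic propositions and every successor $t'$ of $u'$ has a successor $t$ of $u$ with $\sigma(t,t')$, and every initial state of $M'$ is related to some initial state of $M$. -}

module Defs where

open import Data.Bool using (Bool; true; false)
open import Data.Unit using (⊤; tt)
open import Data.Sum using (_⊎_; inj₁; inj₂)
open import Data.Product using (Σ; ∃; ∃-syntax; _×_; _,_; proj₁; proj₂)
open import Data.List using (List; _∷_; []; cartesianProduct)
open import Data.List.Membership.Propositional using (_∈_)
open import Data.List.Membership.Propositional.Properties using (∈-cartesianProduct⁺)
open import Data.List.Relation.Unary.Any using (here; there)
open import Relation.Binary.PropositionalEquality using (_≡_; refl)

-- A Kripke structure over a type AP of atomic propositions:
-- a finite set of states (finiteness = an exhaustive enumeration),
-- a total transition relation, a set of initial states, a labeling.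
record Kripke (AP : Set) : Set₁ where
  field
    State   : Set
    states  : List State
    finite  : ∀ s → s ∈ states
    R       : State → State → Set
    total   : ∀ s → ∃[ t ] R s t
    Init    : State → Set
    I       : State → AP → Bool

open Kripke public

-- The structure 𝒳 over the single atomic proposition x (represented by ⊤):
-- states {0,1} (represented by Bool, 0 = false, 1 = true), both initial,
-- all transitions, I(0,x) = false, I(1,x) = true.
𝒳 : Kripke ⊤
𝒳 = record
  { State  = Bool
  ; states = false ∷ true ∷ []
  ; finite = λ { false → here refl ; true → there (here refl) }
  ; R      = λ _ _ → ⊤
  ; total  = λ s → s , tt
  ; Init   = λ _ → ⊤
  ; I      = λ i _ → i
  }

-- Parallel synchronous composition K ∥ 𝒳 over AP ∪ {x}, with AP ∪ {x}
-- represented by the disjoint union AP ⊎ ⊤ (so x ∉ AP holds by construction).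
_∥𝒳 : {AP : Set} → Kripke AP → Kripke (AP ⊎ ⊤)
K ∥𝒳 = record
  { State  = State K × State 𝒳
  ; states = cartesianProduct (states K) (states 𝒳)
  ; finite = λ { (s , i) → ∈-cartesianProduct⁺ (finite K s) (finite 𝒳 i) }
  ; R      = λ { (s , i) (t , j) → R K s t }
  ; total  = λ { (s , i) → (proj₁ (total K s) , i) , proj₂ (total K s) }
  ; Init   = λ { (s , i) → Init K s }
  ; I      = λ { (s , i) (inj₁ p) → I K s p ; (s , i) (inj₂ _) → I 𝒳 i tt }
  }

record IsBisimulationAP {AP : Set} (K : Kripke AP) (K' : Kripke (AP ⊎ ⊤))
       (ρ : State K → State K' → Set) : Set where
  field
    agree   : ∀ {s s'} → ρ s s' → ∀ p → I K s p ≡ I K' s' (inj₁ p)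
    forth   : ∀ {s s'} → ρ s s' → ∀ {t} → R K s t → ∃[ t' ] (R K' s' t' × ρ t t')
    back    : ∀ {s s'} → ρ s s' → ∀ {t'} → R K' s' t' → ∃[ t ] (R K s t × ρ t t')
    init    : ∀ {s} → Init K s → ∃[ s' ] (Init K' s' × ρ s s')
    init'   : ∀ {s'} → Init K' s' → ∃[ s ] (Init K s × ρ s s')

_≈[x]_ : {AP : Set} → Kripke (AP ⊎ ⊤) → Kripke AP → Set₁
K' ≈[x] K = Σ (State K → State K' → Set) (IsBisimulationAP K K')

-- M simulates M' (both over the same atomic propositions Q, so "common
-- atomic propositions" are all of Q).
record IsSimulation {Q : Set} (M M' : Kripke Q)
       (σ : State M → State M' → Set) : Set where
  field
    agree : ∀ {u u'} → σ u u' → ∀ q → I M u q ≡ I M' u' q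
    step  : ∀ {u u'} → σ u u' → ∀ {t'} → R M' u' t' → ∃[ t ] (R M u t × σ t t')
    init  : ∀ {u'} → Init M' u' → ∃[ u ] (Init M u × σ u u')

Simulates : {Q : Set} → Kripke Q → Kripke Q → Set₁
Simulates M M' = Σ (State M → State M' → Set) (IsSimulation M M')

module Submission where

-- Idea: a bisimulation ρ between K and K' only controls the propositions in
-- AP; the value of x at a state s' of K' is unconstrained.  The composition
-- K ∥ 𝒳 carries an extra bit i that is free to take any value at every step
-- (𝒳 is complete and both of its states are initial), so it can always guess
-- the value of x at the K'-state it is tracking.  Hence the relation
--     σ ⟨s,i⟩ s'  ⟺  ρ s s'  and  i = I'(s', x)
-- is a simulation: AP agrees through ρ, x agrees through the bit, and every
-- move (resp. initial state) of K' is answered by the matching move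
-- (resp. initial state) of K given by the "back" half of ρ, paired with the
-- x-value of the target.  Only the K'-to-K directions of ρ are used.

open import Defs
open import Data.Sum using (_⊎_; inj₁; inj₂)
open import Data.Unit using (⊤; tt)
open import Data.Product using (∃-syntax; _×_; _,_)
open import Relation.Binary.PropositionalEquality using (_≡_; refl; sym)

module _ {AP : Set} (K : Kripke AP) (K' : Kripke (AP ⊎ ⊤))
         (ρ : State K → State K' → Set) (bisim : IsBisimulationAP K K' ρ) where

  open IsBisimulationAP bisim

  x-value : State K' → State 𝒳
  x-value s' = I K' s' (inj₂ tt)

  tracking : State (K ∥𝒳) → State K' → Set
  tracking (s , i) s' = ρ s s' × x-value s' ≡ i

  track : ∀ {s s'} → ρ s s' → tracking (s , x-value s') s'
  track r = r , refl

  tracking-agree : ∀ {u u'} → tracking u u' → ∀ q → I (K ∥𝒳) u q ≡ I K' u' q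
  tracking-agree (r , _)   (inj₁ p)  = agree r p
  tracking-agree (_ , x≡i) (inj₂ tt) = sym x≡i

  tracking-step : ∀ {u u'} → tracking u u' → ∀ {t'} → R K' u' t' →
                  ∃[ t ] (R (K ∥𝒳) u t × tracking t t')
  tracking-step (r , _) s'→t' with back r s'→t'
  ... | t , s→t , r' = (t , _) , s→t , track r'

  tracking-init : ∀ {u'} → Init K' u' → ∃[ u ] (Init (K ∥𝒳) u × tracking u u')
  tracking-init init-u' with init' init-u'
  ... | s , init-s , r = (s , _) , init-s , track r

theorem4p7 : {AP : Set} (K : Kripke AP) (K' : Kripke (AP ⊎ ⊤)) → K' ≈[x] K → Simulates (K ∥𝒳) K'
theorem4p7 K K' (ρ , bisim) =
  tracking K K' ρ bisim ,
  record { agree = tracking-agree K K' ρ bisim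
         ; step  = tracking-step K K' ρ bisim
         ; init  = tracking-init K K' ρ bisim
         }
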